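{- If $n$ is a Carmichael number, then $n\in L_\infty$; that is, there exists $k\in\mathbb{N}$ with $\varphi(n)\mid (n-1)^k$.
   Context: A Carmichael number is a composite positive integer $n$ such that $b^{n-1}\equiv 1\pmod n$ for every integer $b$ coprime to $n$. $\varphi$ is Euler's totient function. For $k\in\mathbb{N}$, $L_k=\{n\in\mathbb{N} : \varphi(n)\mid (n-1)^k\}$ and $L_\infty=\bigcup_{k\ge1}L_k$. -}

module Defs where

open import Data.Nat using (ℕ; suc; _∸_)
open import Data.Nat.Coprimality using (Coprime; coprime?)
open import Data.Nat.Primality using (Composite)
open import Data.List using (List; length; filter; upTo; map)
open import Data.Integer as ℤ using (ℤ; +_; ∣_∣)
open import Data.Integer.Divisibility as ℤD using ()
open import Data.Product using (_×_)

-- Euler's totient: φ(n) = #{ k : 1 ≤ k ≤ n , gcd(k, n) = 1 }  (so φ(0) = 0, φ(1) = 1)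
φ : ℕ → ℕ
φ n = length (filter (λ k → coprime? k n) (map suc (upTo n)))

_≡_[mod_] : ℤ → ℤ → ℕ → Set
a ≡ b [mod n ] = (+ n) ℤD.∣ (a ℤ.- b)

Carmichael : ℕ → Set
Carmichael n = Composite n × (∀ (b : ℤ) → Coprime ∣ b ∣ n → (b ℤ.^ (n ∸ 1)) ≡ ℤ.+ 1 [mod n ])

module Submission where

-- A Carmichael number is squarefree, and by Korselt's criterion p − 1 ∣ n − 1
-- for each prime p ∣ n. Writing n = p₁⋯p_k, multiplicativity of φ gives
-- φ(n) = (p₁ − 1)⋯(p_k − 1), which therefore divides (n − 1)^k.

module Arithmetic where

  open import Data.Nat using (_+_; _*_; _<_; nonTrivial⇒n>1; nonTrivial⇒≢1)
  open import Data.Nat.Divisibility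
  open import Data.Nat.Properties using (+-comm)
  open import Data.Nat.Coprimality as Coprime using (Coprime; coprime-divisor)
  open import Data.Nat.Primality using (Prime; prime⇒nonTrivial; prime⇒irreducible)
  open import Data.Product using (_×_; _,_)
  open import Function.Bundles using (_⇔_; mk⇔)
  open import Data.Sum using (inj₁; inj₂)
  open import Relation.Nullary using (¬_; contradiction)
  open import Relation.Binary.PropositionalEquality

  prime>1 : ∀ {p} → Prime p → 1 < p
  prime>1 {p} pr = nonTrivial⇒n>1 p {{prime⇒nonTrivial pr}}

  prime∤1 : ∀ {p} → Prime p → ¬ (p ∣ 1)
  prime∤1 pr p∣1 = nonTrivial⇒≢1 {{prime⇒nonTrivial pr}} (∣1⇒≡1 p∣1)

  prime∤⇒coprime : ∀ {p x} → Prime p → ¬ (p ∣ x) → Coprime p x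
  prime∤⇒coprime pr p∤x (i∣p , i∣x) with prime⇒irreducible pr i∣p
  ... | inj₁ i≡1    = i≡1
  ... | inj₂ refl   = contradiction i∣x p∤x

  coprime-∣ʳ : ∀ {a b c} → c ∣ b → Coprime a b → Coprime a c
  coprime-∣ʳ c∣b cop (i∣a , i∣c) = cop (i∣a , ∣-trans i∣c c∣b)

  coprime-*ʳ : ∀ {a b c} → Coprime a b → Coprime a c → Coprime a (b * c)
  coprime-*ʳ a⊥b a⊥c {i} (i∣a , i∣bc) =
    a⊥c (i∣a , coprime-divisor (λ (j∣i , j∣b) → a⊥b (∣-trans j∣i i∣a , j∣b)) i∣bc)

  coprime-+ʳ⇔ : ∀ {k m} → Coprime (k + m) m ⇔ Coprime k m
  coprime-+ʳ⇔ {k} {m} = mk⇔ to from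
    where
    to : Coprime (k + m) m → Coprime k m
    to k+m⊥m (i∣k , i∣m) = k+m⊥m (∣m∣n⇒∣m+n i∣k i∣m , i∣m)
    from : Coprime k m → Coprime (k + m) m
    from k⊥m {i} (i∣k+m , i∣m) = k⊥m (∣m+n∣m⇒∣n (subst (i ∣_) (+-comm k m) i∣k+m) i∣m , i∣m)

  coprime-prime*⇔ : ∀ {p k m} → Prime p → Coprime k (p * m) ⇔ (Coprime k m × ¬ (p ∣ k))
  coprime-prime*⇔ {p} {k} {m} pr = mk⇔ to from
    where
    to : Coprime k (p * m) → Coprime k m × ¬ (p ∣ k)
    to k⊥pm = coprime-∣ʳ (n∣m*n p) k⊥pm , λ p∣k → nonTrivial⇒≢1 {{prime⇒nonTrivial pr}} (k⊥pm (p∣k , m∣m*n m))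
    from : Coprime k m × ¬ (p ∣ k) → Coprime k (p * m)
    from (k⊥m , p∤k) = coprime-*ʳ (Coprime.sym (prime∤⇒coprime pr p∤k)) k⊥m

  coprime-prime*ˡ⇔ : ∀ {p j m} → Prime p → ¬ (p ∣ m) → Coprime (p * j) m ⇔ Coprime j m
  coprime-prime*ˡ⇔ {p} {j} {m} pr p∤m = mk⇔ to from
    where
    to : Coprime (p * j) m → Coprime j m
    to pj⊥m (i∣j , i∣m) = pj⊥m (∣-trans i∣j (n∣m*n p) , i∣m)
    from : Coprime j m → Coprime (p * j) m
    from j⊥m = Coprime.sym (coprime-*ʳ (Coprime.sym (prime∤⇒coprime pr p∤m)) (Coprime.sym j⊥m))

module Congruence where

  open import Data.Nat as ℕ using (ℕ; zero; suc)
  import Data.Nat.Properties as ℕ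
  import Data.Nat.Divisibility as ℕ
  open import Data.Nat.Coprimality as Coprime using (Coprime)
  open import Data.Nat.GCD using (gcd; gcd-GCD; module Bézout)
  open import Data.Nat.Primality using (Prime; euclidsLemma)
  open import Data.Integer as ℤ using (ℤ; +_; _+_; _-_; _*_; -_; _^_; ∣_∣; 0ℤ; 1ℤ)
  import Data.Integer.Properties as ℤ
  import Data.Integer.Divisibility.Signed as Signed
  open import Data.Integer.Tactic.RingSolver using (solve-∀)
  open import Data.Product using (_,_)
  open import Data.Sum using (_⊎_; inj₁; inj₂)
  open import Relation.Nullary using (¬_)
  open import Relation.Binary.PropositionalEquality
  open import Defs using (_≡_[mod_])
  open Arithmetic using (prime∤⇒coprime)

  -- Congruence of integers modulo n: the relation _≡_[mod_] of Defs, packaged as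
  -- a record so that the two sides can be inferred from a proof's type.
  infix 4 _≈_[mod_]
  record _≈_[mod_] (a b : ℤ) (n : ℕ) : Set where
    constructor congruent
    field difference : + n Signed.∣ (a - b)

  fromDefs : ∀ {n a b} → a ≡ b [mod n ] → a ≈ b [mod n ]
  fromDefs h = congruent (Signed.∣ᵤ⇒∣ h)

  by-difference : ∀ {n x a b} → x ≡ a - b → + n Signed.∣ x → a ≈ b [mod n ]
  by-difference eq h = congruent (subst (_ Signed.∣_) eq h)

  ≡⇒mod : ∀ {n a b} → a ≡ b → a ≈ b [mod n ]
  ≡⇒mod {a = a} refl = congruent (Signed.divides 0ℤ (ℤ.+-inverseʳ a))

  mod-sym : ∀ {n a b} → a ≈ b [mod n ] → b ≈ a [mod n ]
  mod-sym {a = a} {b} (congruent h) = by-difference (flip a b) (Signed.∣m⇒∣-m h)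
    where flip : ∀ a b → - (a - b) ≡ b - a
          flip = solve-∀

  mod-trans : ∀ {n a b c} → a ≈ b [mod n ] → b ≈ c [mod n ] → a ≈ c [mod n ]
  mod-trans {a = a} {b} {c} (congruent h) (congruent k) =
    by-difference (chain a b c) (Signed.∣m∣n⇒∣m+n h k)
    where chain : ∀ a b c → (a - b) + (b - c) ≡ a - c
          chain = solve-∀

  mod-+ : ∀ {n a b c e} → a ≈ b [mod n ] → c ≈ e [mod n ] → a + c ≈ b + e [mod n ]
  mod-+ {a = a} {b} {c} {e} (congruent h) (congruent k) =
    by-difference (regroup a b c e) (Signed.∣m∣n⇒∣m+n h k)
    where regroup : ∀ a b c e → (a - b) + (c - e) ≡ (a + c) - (b + e)
          regroup = solve-∀

  mod-* : ∀ {n a b c e} → a ≈ b [mod n ] → c ≈ e [mod n ] → a * c ≈ b * e [mod n ]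
  mod-* {a = a} {b} {c} {e} (congruent h) (congruent k) =
    by-difference (expand a b c e) (Signed.∣m∣n⇒∣m+n (Signed.∣m⇒∣m*n c h) (Signed.∣n⇒∣m*n b k))
    where expand : ∀ a b c e → (a - b) * c + b * (c - e) ≡ a * c - b * e
          expand = solve-∀

  multiple≈0 : ∀ {n} x → + n * x ≈ 0ℤ [mod n ]
  multiple≈0 {n} x = by-difference (minus-zero (+ n * x)) (Signed.∣m⇒∣m*n x Signed.∣-refl)
    where minus-zero : ∀ y → y ≡ y - 0ℤ
          minus-zero = solve-∀

  mod-difference : ∀ {n a b c e} → a ≈ b [mod n ] → c ≈ e [mod n ] → a - c ≈ b - e [mod n ]
  mod-difference {a = a} {b} {c} {e} (congruent h) (congruent k) =
    by-difference (regroup a b c e) (Signed.∣m∣n⇒∣m-n h k)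
    where regroup : ∀ a b c e → (a - b) - (c - e) ≡ (a - c) - (b - e)
          regroup = solve-∀

  mod-^ : ∀ {n a b} k → a ≈ b [mod n ] → a ^ k ≈ b ^ k [mod n ]
  mod-^ zero    h = ≡⇒mod refl
  mod-^ (suc k) h = mod-* h (mod-^ k h)

  mod-weaken : ∀ {d n a b} → d ℕ.∣ n → a ≈ b [mod n ] → a ≈ b [mod d ]
  mod-weaken d∣n (congruent h) = congruent (Signed.∣-trans (Signed.∣ᵤ⇒∣ d∣n) h)

  mod-0⇒∣ : ∀ {n x} → x ≈ 0ℤ [mod n ] → n ℕ.∣ ∣ x ∣
  mod-0⇒∣ {x = x} (congruent h) = subst (_ ℕ.∣_) (cong ∣_∣ (ℤ.+-identityʳ x)) (Signed.∣⇒∣ᵤ h)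

  ∣⇒mod-0 : ∀ {n x} → n ℕ.∣ ∣ x ∣ → x ≈ 0ℤ [mod n ]
  ∣⇒mod-0 {x = x} h = congruent (Signed.∣ᵤ⇒∣ (subst (_ ℕ.∣_) (cong ∣_∣ (sym (ℤ.+-identityʳ x))) h))

  mod⇒∣ : ∀ {n a b} → a ≈ b [mod n ] → n ℕ.∣ ∣ a - b ∣
  mod⇒∣ (congruent h) = Signed.∣⇒∣ᵤ h

  ∣[+m]-[+k]∣ : ∀ {m k} → m ℕ.≤ k → ∣ + m - + k ∣ ≡ k ℕ.∸ m
  ∣[+m]-[+k]∣ {m} {k} m≤k = trans (cong ∣_∣ (ℤ.[+m]-[+n]≡m⊖n m k)) (ℤ.∣⊖∣-≤ m≤k)

  ℕ-multiple⇒mod : ∀ {n a b t} → a ≡ b ℕ.+ n ℕ.* t → + a ≈ + b [mod n ]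
  ℕ-multiple⇒mod {n} {b = b} {t} refl = mod-sym (congruent (Signed.∣ᵤ⇒∣
    (subst (n ℕ.∣_) (sym (trans (∣[+m]-[+k]∣ (ℕ.m≤m+n b (n ℕ.* t))) (ℕ.m+n∸m≡n b (n ℕ.* t)))) (ℕ.m∣m*n t))))

  <⇒mod-distinct : ∀ {n m k} → m ℕ.< k → k ℕ.< n → ¬ (+ m ≈ + k [mod n ])
  <⇒mod-distinct {n} {m} {k} m<k k<n m≈k = ℕ.<⇒≱ (ℕ.≤-<-trans (ℕ.m∸n≤m k m) k<n) n≤k∸m
    where
    n≤k∸m : n ℕ.≤ k ℕ.∸ m
    n≤k∸m = ℕ.∣⇒≤ {{ℕ.>-nonZero (ℕ.m<n⇒0<n∸m m<k)}}
              (subst (n ℕ.∣_) (∣[+m]-[+k]∣ (ℕ.<⇒≤ m<k)) (mod⇒∣ m≈k))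

  mod-euclid : ∀ {p x y} → Prime p → x * y ≈ 0ℤ [mod p ] → x ≈ 0ℤ [mod p ] ⊎ y ≈ 0ℤ [mod p ]
  mod-euclid {x = x} {y} pr h with euclidsLemma ∣ x ∣ ∣ y ∣ pr (subst (_ ℕ.∣_) (ℤ.abs-* x y) (mod-0⇒∣ h))
  ... | inj₁ p∣x = inj₁ (∣⇒mod-0 p∣x)
  ... | inj₂ p∣y = inj₂ (∣⇒mod-0 p∣y)

  mod⇒difference≈0 : ∀ {n a b} → a ≈ b [mod n ] → a - b ≈ 0ℤ [mod n ]
  mod⇒difference≈0 {a = a} {b} (congruent h) = by-difference (minus-zero (a - b)) h
    where minus-zero : ∀ x → x ≡ x - 0ℤ
          minus-zero = solve-∀

  difference≈0⇒mod : ∀ {n a b} → a - b ≈ 0ℤ [mod n ] → a ≈ b [mod n ]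
  difference≈0⇒mod {a = a} {b} (congruent h) = by-difference (minus-zero (a - b)) h
    where minus-zero : ∀ x → x - 0ℤ ≡ x
          minus-zero = solve-∀

  -- If x^e ≡ 1 and x^f ≡ 1 then x^gcd(e,f) ≡ 1: by Bézout, gcd(e,f) + v·f = u·e
  -- (or symmetrically), and x^(u·e) ≡ 1, x^(v·f) ≡ 1 cancel down to x^gcd(e,f).
  module _ {n : ℕ} {x : ℤ} where

    pow≈1-multiple : ∀ k e → x ^ e ≈ 1ℤ [mod n ] → x ^ (k ℕ.* e) ≈ 1ℤ [mod n ]
    pow≈1-multiple k e h = subst₂ (λ u v → u ≈ v [mod n ])
      (trans (ℤ.^-*-assoc x e k) (cong (x ^_) (ℕ.*-comm e k))) (ℤ.^-zeroˡ k) (mod-^ k h)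

    pow≈1-cancel : ∀ g b → x ^ (g ℕ.+ b) ≈ 1ℤ [mod n ] → x ^ b ≈ 1ℤ [mod n ] → x ^ g ≈ 1ℤ [mod n ]
    pow≈1-cancel g b h₁ h₂ = mod-trans (≡⇒mod (sym (ℤ.*-identityʳ (x ^ g))))
      (mod-trans (mod-* (≡⇒mod {a = x ^ g} refl) (mod-sym h₂))
        (subst (λ u → u ≈ 1ℤ [mod n ]) (ℤ.^-distribˡ-+-* x g b) h₁))

    pow≈1-gcd : ∀ e f → x ^ e ≈ 1ℤ [mod n ] → x ^ f ≈ 1ℤ [mod n ] → x ^ gcd e f ≈ 1ℤ [mod n ]
    pow≈1-gcd e f hₑ h_f with Bézout.identity (gcd-GCD e f)
    ... | Bézout.+- u v eq = pow≈1-cancel (gcd e f) (v ℕ.* f)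
            (subst (λ k → x ^ k ≈ 1ℤ [mod n ]) (sym eq) (pow≈1-multiple u e hₑ)) (pow≈1-multiple v f h_f)
    ... | Bézout.-+ u v eq = pow≈1-cancel (gcd e f) (u ℕ.* e)
            (subst (λ k → x ^ k ≈ 1ℤ [mod n ]) (sym eq) (pow≈1-multiple v f h_f)) (pow≈1-multiple u e hₑ)

  -- An integer ≡ 1 modulo m is coprime to m: a common divisor i has b ≡ 0 and
  -- b ≡ 1 modulo i, hence i ∣ 1.
  mod-1⇒coprime : ∀ {m b} → b ≈ 1ℤ [mod m ] → Coprime ∣ b ∣ m
  mod-1⇒coprime b≈1 (i∣b , i∣m) =
    ℕ.∣1⇒≡1 (mod-0⇒∣ (mod-trans (mod-sym (mod-weaken i∣m b≈1)) (∣⇒mod-0 i∣b)))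

  mod-unit⇒coprime : ∀ {p a b} → Prime p → ¬ (p ℕ.∣ a) → b ≈ + a [mod p ] → Coprime ∣ b ∣ p
  mod-unit⇒coprime pr p∤a b≈a = Coprime.sym (prime∤⇒coprime pr λ p∣b →
    p∤a (mod-0⇒∣ (mod-trans (mod-sym b≈a) (∣⇒mod-0 p∣b))))

module Fermat where

  open import Data.Nat as ℕ using (ℕ; zero; suc; _+_; _*_; _∸_; _^_; _<_; _!; z≤n; s≤s)
  open import Data.Nat.Properties
  open import Data.Nat.Divisibility
  open import Data.Nat.DivMod using (m*[n/m]≡n)
  open import Data.Nat.Combinatorics using (_C_; nCn≡1; nCk≡n!/k![n-k]!; k![n∸k]!∣n!)
  open import Data.Nat.Primality using (Prime; euclidsLemma; prime⇒nonZero)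
  open import Data.Nat.Tactic.RingSolver using (solve-∀)
  open import Data.Integer as ℤ using (+_; 0ℤ; 1ℤ)
  import Data.Integer.Properties as ℤ
  import Data.Integer.Tactic.RingSolver as ℤ-Solver
  open import Data.Fin as Fin using (Fin; toℕ; fromℕ; inject₁)
  open import Data.Fin.Properties using (toℕ-fromℕ; toℕ-inject₁; toℕ<n)
  open import Data.Product using (∃; _,_)
  open import Data.Sum using (inj₁; inj₂)
  open import Relation.Nullary using (¬_; contradiction)
  open import Relation.Binary.PropositionalEquality
  import Algebra.Properties.CommutativeSemiring.Binomial +-*-commutativeSemiring as Binomial
  import Algebra.Properties.Semiring.Exp +-*-semiring as Exp
  import Algebra.Properties.Monoid.Mult +-0-monoid as Mult
  import Algebra.Properties.Monoid.Sum +-0-monoid as Sum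
  open Arithmetic using (prime>1; prime∤1)
  open Congruence

  -- Every factor of m! is below p, so a prime p does not divide m! when m < p.
  prime∤factorial : ∀ {p} → Prime p → ∀ m → m < p → ¬ (p ∣ m !)
  prime∤factorial pr zero    m<p = prime∤1 pr
  prime∤factorial pr (suc m) m<p p∣m! with euclidsLemma (suc m) (m !) pr p∣m!
  ... | inj₁ p∣1+m = <⇒≱ m<p (∣⇒≤ p∣1+m)
  ... | inj₂ p∣m!  = prime∤factorial pr m (<-trans (n<1+n m) m<p) p∣m!

  n∣n! : ∀ n → .{{ℕ.NonZero n}} → n ∣ n !
  n∣n! (suc n) = m∣m*n (n !)

  -- p divides (p C k) for 0 < k < p: p ∣ p! = (p C k)·k!·(p∸k)!, but p divides
  -- neither factorial.
  prime∣choose : ∀ {p} → Prime p → ∀ k → 0 < k → k < p → p ∣ p C k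
  prime∣choose {p} pr k 0<k k<p with euclidsLemma (p C k) (k ! * (p ∸ k) !) pr p∣product
    where
    instance
      factorials≢0 : ℕ.NonZero (k ! * (p ∸ k) !)
      factorials≢0 = k !* (p ∸ k) !≢0
    p!≡product : (p C k) * (k ! * (p ∸ k) !) ≡ p !
    p!≡product = begin
      (p C k) * (k ! * (p ∸ k) !)                       ≡⟨ cong (_* (k ! * (p ∸ k) !)) (nCk≡n!/k![n-k]! (<⇒≤ k<p)) ⟩
      (p ! ℕ./ (k ! * (p ∸ k) !)) * (k ! * (p ∸ k) !)   ≡⟨ *-comm _ (k ! * (p ∸ k) !) ⟩
      (k ! * (p ∸ k) !) * (p ! ℕ./ (k ! * (p ∸ k) !))   ≡⟨ m*[n/m]≡n (k![n∸k]!∣n! (<⇒≤ k<p)) ⟩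
      p !                                               ∎
      where open ≡-Reasoning
    p∣product : p ∣ (p C k) * (k ! * (p ∸ k) !)
    p∣product = subst (p ∣_) (sym p!≡product) (n∣n! p {{prime⇒nonZero pr}})
  ... | inj₁ p∣pCk = p∣pCk
  ... | inj₂ p∣factorials with euclidsLemma (k !) ((p ∸ k) !) pr p∣factorials
  ...   | inj₁ p∣k!     = contradiction p∣k! (prime∤factorial pr k k<p)
  ...   | inj₂ p∣[p∸k]! = contradiction p∣[p∸k]! (prime∤factorial pr (p ∸ k) (∸-monoʳ-< 0<k (<⇒≤ k<p)))

  -- The power and the scalar multiple of the semiring library (used by its
  -- binomial theorem) agree with ℕ's own _^_ and _*_.
  ^-agrees : ∀ x n → x Exp.^ n ≡ x ^ n
  ^-agrees x zero    = refl
  ^-agrees x (suc n) = cong (x *_) (^-agrees x n)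

  ×-agrees : ∀ n x → n Mult.× x ≡ n * x
  ×-agrees zero    x = refl
  ×-agrees (suc n) x = cong (λ y → x + y) (×-agrees n x)

  binomialTerm≡ : ∀ a n (k : Fin (suc n)) → Binomial.binomialTerm a 1 n k ≡ (n C toℕ k) * a ^ toℕ k
  binomialTerm≡ a n k = begin
    (n C toℕ k) Mult.× (a Exp.^ toℕ k * 1 Exp.^ (n ∸ toℕ k)) ≡⟨ ×-agrees (n C toℕ k) _ ⟩
    (n C toℕ k) * (a Exp.^ toℕ k * 1 Exp.^ (n ∸ toℕ k))      ≡⟨ cong ((n C toℕ k) *_) (cong₂ _*_ (^-agrees a (toℕ k)) one) ⟩
    (n C toℕ k) * (a ^ toℕ k * 1)                             ≡⟨ cong ((n C toℕ k) *_) (*-identityʳ (a ^ toℕ k)) ⟩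
    (n C toℕ k) * a ^ toℕ k                                   ∎
    where
    open ≡-Reasoning
    one : 1 Exp.^ (n ∸ toℕ k) ≡ 1
    one = trans (^-agrees 1 (n ∸ toℕ k)) (^-zeroˡ (n ∸ toℕ k))

  ∣-sum : ∀ {d} n (t : Fin n → ℕ) → (∀ i → d ∣ t i) → d ∣ Sum.sum t
  ∣-sum zero    t d∣t = _ ∣0
  ∣-sum (suc n) t d∣t = ∣m∣n⇒∣m+n (d∣t Fin.zero) (∣-sum n (λ i → t (Fin.suc i)) (λ i → d∣t (Fin.suc i)))

  module Expansion (a m : ℕ) where

    term : Fin (suc (suc m)) → ℕ
    term = Binomial.binomialTerm a 1 (suc m)

    middle : Fin m → ℕ
    middle i = term (Fin.suc (inject₁ i))

    expansion : (a + 1) ^ suc m ≡ 1 + (Sum.sum middle + a ^ suc m)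
    expansion = begin
      (a + 1) ^ suc m                                  ≡⟨ sym (^-agrees (a + 1) (suc m)) ⟩
      (a + 1) Exp.^ suc m                              ≡⟨ Binomial.theorem (suc m) a 1 ⟩
      term Fin.zero + Sum.sum (λ i → term (Fin.suc i)) ≡⟨ cong (λ y → term Fin.zero + y) (Sum.sum-init-last (λ i → term (Fin.suc i))) ⟩
      term Fin.zero + (Sum.sum middle + term last)     ≡⟨ cong₂ (λ u v → u + (Sum.sum middle + v)) first≡1 last≡a^p ⟩
      1 + (Sum.sum middle + a ^ suc m)                 ∎
      where
      open ≡-Reasoning
      last : Fin (suc (suc m))
      last = Fin.suc (fromℕ m)
      first≡1 : term Fin.zero ≡ 1
      first≡1 = binomialTerm≡ a (suc m) Fin.zero
      last≡a^p : term last ≡ a ^ suc m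
      last≡a^p = begin
        term last                                   ≡⟨ binomialTerm≡ a (suc m) last ⟩
        (suc m C toℕ last) * a ^ toℕ last           ≡⟨ cong (λ k → (suc m C k) * a ^ k) (cong suc (toℕ-fromℕ m)) ⟩
        (suc m C suc m) * a ^ suc m                 ≡⟨ cong (_* a ^ suc m) (nCn≡1 (suc m)) ⟩
        1 * a ^ suc m                               ≡⟨ *-identityˡ (a ^ suc m) ⟩
        a ^ suc m                                   ∎

    middle-divisible : Prime (suc m) → suc m ∣ Sum.sum middle
    middle-divisible pr = ∣-sum m middle λ i →
      subst (suc m ∣_) (sym (binomialTerm≡ a (suc m) (Fin.suc (inject₁ i))))
        (∣m⇒∣m*n _ (prime∣choose pr (suc (toℕ (inject₁ i))) (s≤s z≤n)
          (s≤s (subst (_< m) (sym (toℕ-inject₁ i)) (toℕ<n i)))))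

  freshman : ∀ {p} → Prime p → ∀ a → ∃ λ s → (a + 1) ^ p ≡ a ^ p + 1 + p * s
  freshman {zero}  pr a = contradiction (prime>1 pr) λ ()
  freshman {suc m} pr a with Expansion.middle-divisible a m pr
  ... | divides s middle≡s*p = s , (begin
    (a + 1) ^ suc m                         ≡⟨ Expansion.expansion a m ⟩
    1 + (Sum.sum middle + a ^ suc m)        ≡⟨ cong (λ x → 1 + (x + a ^ suc m)) middle≡s*p ⟩
    1 + (s * suc m + a ^ suc m)             ≡⟨ rearrange s (a ^ suc m) (suc m) ⟩
    a ^ suc m + 1 + suc m * s               ∎)
    where
    open ≡-Reasoning
    open Expansion a m using (middle)
    rearrange : ∀ s x p → 1 + (s * p + x) ≡ x + 1 + p * s
    rearrange = solve-∀

  fermatℕ : ∀ {p} → Prime p → ∀ a → ∃ λ t → a ^ p ≡ a + p * t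
  fermatℕ {zero}  pr zero = contradiction (prime>1 pr) λ ()
  fermatℕ {suc m} pr zero = 0 , sym (*-zeroʳ (suc m))
  fermatℕ {p} pr (suc a) with fermatℕ pr a | freshman pr a
  ... | t , a^p≡ | s , [a+1]^p≡ = t + s , (begin
    suc a ^ p                ≡⟨ cong (_^ p) (+-comm 1 a) ⟩
    (a + 1) ^ p              ≡⟨ [a+1]^p≡ ⟩
    a ^ p + 1 + p * s        ≡⟨ cong (λ x → x + 1 + p * s) a^p≡ ⟩
    a + p * t + 1 + p * s    ≡⟨ rearrange a p t s ⟩
    suc a + p * (t + s)      ∎)
    where
    open ≡-Reasoning
    rearrange : ∀ a p t s → a + p * t + 1 + p * s ≡ suc a + p * (t + s)
    rearrange = solve-∀

  pos-^ : ∀ a n → + (a ^ n) ≡ (+ a) ℤ.^ n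
  pos-^ a zero    = refl
  pos-^ a (suc n) = trans (ℤ.pos-* a (a ^ n)) (cong (+ a ℤ.*_) (pos-^ a n))

  fermat : ∀ {p} → Prime p → ∀ a → (+ a) ℤ.^ p ≈ + a [mod p ]
  fermat {p} pr a with fermatℕ pr a
  ... | t , a^p≡ = subst (λ x → x ≈ + a [mod p ]) (pos-^ a p) (ℕ-multiple⇒mod a^p≡)

  -- For p ∤ a: a^(p−1) ≡ 1 (mod p), cancelling a from a·(a^(p−1) − 1) ≡ 0.
  fermat-unit : ∀ {p} → Prime p → ∀ a → ¬ (p ∣ a) → (+ a) ℤ.^ (p ∸ 1) ≈ 1ℤ [mod p ]
  fermat-unit {zero}  pr a p∤a = contradiction (prime>1 pr) λ ()
  fermat-unit {suc q} pr a p∤a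
    with mod-euclid {x = + a} {y = (+ a) ℤ.^ q ℤ.- 1ℤ} pr
           (subst (λ x → x ≈ 0ℤ [mod suc q ]) (factor (+ a) ((+ a) ℤ.^ q)) (mod⇒difference≈0 (fermat pr a)))
    where factor : ∀ x y → x ℤ.* y ℤ.- x ≡ x ℤ.* (y ℤ.- 1ℤ)
          factor = ℤ-Solver.solve-∀
  ... | inj₁ a≈0     = contradiction (mod-0⇒∣ a≈0) p∤a
  ... | inj₂ a^q-1≈0 = difference≈0⇒mod a^q-1≈0

module Lagrange where

  open import Data.Nat as ℕ using (ℕ; zero; suc; _<_; _≤_; _∸_; z≤n; s≤s)
  import Data.Nat.Properties as ℕ
  open import Data.Nat.Primality using (Prime)
  open import Data.Integer as ℤ using (ℤ; +_; _+_; _-_; _*_; -_; _^_; 0ℤ; 1ℤ; -1ℤ)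
  import Data.Integer.Properties as ℤ
  open import Data.Integer.Tactic.RingSolver using (solve-∀)
  open import Data.List using (List; []; _∷_; length; applyUpTo)
  open import Data.List.Properties using (length-applyUpTo)
  open import Data.List.Relation.Unary.All as All using (All; []; _∷_)
  import Data.List.Relation.Unary.All.Properties as All
  open import Data.List.Relation.Unary.AllPairs as AllPairs using (AllPairs; []; _∷_)
  import Data.List.Relation.Unary.AllPairs.Properties as AllPairs
  open import Data.Sum using (inj₁; inj₂)
  open import Data.Product using (_,_)
  open import Data.Empty using (⊥)
  open import Relation.Nullary using (¬_; contradiction)
  open import Relation.Binary.PropositionalEquality
  open Arithmetic using (prime>1; prime∤1)
  open Congruence

  -- Integer polynomials as coefficient lists, constant term first.
  Poly : Set
  Poly = List ℤ

  eval : Poly → ℤ → ℤ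
  eval []       x = 0ℤ
  eval (c ∷ cs) x = c + x * eval cs x

  eval-constant : ∀ c x → eval (c ∷ []) x ≡ c
  eval-constant c x = trans (cong (λ v → c + v) (ℤ.*-zeroʳ x)) (ℤ.+-identityʳ c)

  -- The quotient of P by (x − r), computed by synthetic division.
  divide : ℤ → Poly → Poly
  divide r []            = []
  divide r (c ∷ [])      = []
  divide r (c ∷ c′ ∷ cs) = eval (c′ ∷ cs) r ∷ divide r (c′ ∷ cs)

  remainder-theorem : ∀ r P x → eval P x ≡ (x - r) * eval (divide r P) x + eval P r
  remainder-theorem r []            x = zero-poly x r
    where zero-poly : ∀ x r → 0ℤ ≡ (x - r) * 0ℤ + 0ℤ
          zero-poly = solve-∀
  remainder-theorem r (c ∷ [])      x = constant c x r
    where constant : ∀ c x r → c + x * 0ℤ ≡ (x - r) * 0ℤ + (c + r * 0ℤ)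
          constant = solve-∀
  remainder-theorem r (c ∷ c′ ∷ cs) x = begin
    c + x * eval (c′ ∷ cs) x                                       ≡⟨ cong (λ v → c + x * v) (remainder-theorem r (c′ ∷ cs) x) ⟩
    c + x * ((x - r) * eval (divide r (c′ ∷ cs)) x + eval (c′ ∷ cs) r)
      ≡⟨ step c x r (eval (divide r (c′ ∷ cs)) x) (eval (c′ ∷ cs) r) ⟩
    (x - r) * (eval (c′ ∷ cs) r + x * eval (divide r (c′ ∷ cs)) x) + (c + r * eval (c′ ∷ cs) r) ∎
    where
    open ≡-Reasoning
    step : ∀ c x r q v → c + x * ((x - r) * q + v) ≡ (x - r) * (v + x * q) + (c + r * v)
    step = solve-∀

  module _ (p : ℕ) where

    LeadingUnit : Poly → Set
    LeadingUnit []            = ⊥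
    LeadingUnit (c ∷ [])      = ¬ (c ≈ 0ℤ [mod p ])
    LeadingUnit (c ∷ c′ ∷ cs) = LeadingUnit (c′ ∷ cs)

    Root : Poly → ℤ → Set
    Root P x = eval P x ≈ 0ℤ [mod p ]

    Distinct : List ℤ → Set
    Distinct = AllPairs (λ r s → ¬ (r ≈ s [mod p ]))

  divide-leading : ∀ {p} r c c′ cs → LeadingUnit p (c ∷ c′ ∷ cs) → LeadingUnit p (divide r (c ∷ c′ ∷ cs))
  divide-leading r c c′ []         lead = λ c′≈0 → lead (mod-trans (≡⇒mod (sym (eval-constant c′ r))) c′≈0)
  divide-leading r c c′ (c″ ∷ cs) lead = divide-leading r c′ c″ cs lead

  length-divide : ∀ r c cs → length (divide r (c ∷ cs)) ≡ length cs
  length-divide r c []        = refl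
  length-divide r c (c′ ∷ cs) = cong suc (length-divide r c′ cs)

  -- Modulo a prime, a root s ≢ r of P is a root of P / (x − r): by the remainder
  -- theorem (s − r)·Q(s) ≡ P(s) − P(r) ≡ 0, and s − r ≢ 0.
  divide-roots : ∀ {p} → Prime p → ∀ r P → Root p P r → ∀ {s} → ¬ (r ≈ s [mod p ]) → Root p P s → Root p (divide r P) s
  divide-roots {p} pr r P Pr≈0 {s} r≉s Ps≈0 with mod-euclid {x = s - r} pr (mod-trans (≡⇒mod product≡) (mod-difference Ps≈0 Pr≈0))
    where
    product≡ : (s - r) * eval (divide r P) s ≡ eval P s - eval P r
    product≡ = begin
      (s - r) * eval (divide r P) s                          ≡⟨ cancel ((s - r) * eval (divide r P) s) (eval P r) ⟩
      ((s - r) * eval (divide r P) s + eval P r) - eval P r  ≡⟨ cong (_- eval P r) (sym (remainder-theorem r P s)) ⟩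
      eval P s - eval P r                                    ∎
      where
      open ≡-Reasoning
      cancel : ∀ u v → u ≡ (u + v) - v
      cancel = solve-∀
  ... | inj₁ s-r≈0 = contradiction (mod-sym (difference≈0⇒mod s-r≈0)) r≉s
  ... | inj₂ Qs≈0  = Qs≈0

  lagrange : ∀ {p} → Prime p → ∀ xs P → LeadingUnit p P → All (Root p P) xs → Distinct p xs →
             length xs < length P
  lagrange pr []       (c ∷ cs)      lead roots distinct = s≤s z≤n
  lagrange pr (r ∷ rs) (c ∷ [])      lead (Pr≈0 ∷ _) distinct =
    contradiction (mod-trans (≡⇒mod (sym (eval-constant c r))) Pr≈0) lead
  lagrange pr (r ∷ rs) (c ∷ c′ ∷ cs) lead (Pr≈0 ∷ roots) (r≉rs ∷ distinct) =
    s≤s (subst (length rs <_) (length-divide r c (c′ ∷ cs))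
      (lagrange pr rs (divide r (c ∷ c′ ∷ cs)) (divide-leading r c c′ cs lead)
        (All.zipWith (λ (r≉s , Ps≈0) → divide-roots pr r (c ∷ c′ ∷ cs) Pr≈0 r≉s Ps≈0) (r≉rs , roots))
        distinct))

  monomial : ℕ → Poly
  monomial zero    = 1ℤ ∷ []
  monomial (suc d) = 0ℤ ∷ monomial d

  unity : ℕ → Poly
  unity d = -1ℤ ∷ monomial d

  eval-monomial : ∀ d x → eval (monomial d) x ≡ x ^ d
  eval-monomial zero    x = eval-constant 1ℤ x
  eval-monomial (suc d) x = trans (ℤ.+-identityˡ (x * eval (monomial d) x)) (cong (x *_) (eval-monomial d x))

  eval-unity : ∀ d x → eval (unity d) x ≡ x ^ suc d - 1ℤ
  eval-unity d x = trans (swap x (eval (monomial d) x)) (cong (λ v → x * v - 1ℤ) (eval-monomial d x))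
    where swap : ∀ x y → -1ℤ + x * y ≡ x * y - 1ℤ
          swap = solve-∀

  length-unity : ∀ d → length (unity d) ≡ suc (suc d)
  length-unity d = cong suc (length-monomial d)
    where length-monomial : ∀ d → length (monomial d) ≡ suc d
          length-monomial zero    = refl
          length-monomial (suc d) = cong suc (length-monomial d)

  monomial-leading : ∀ {p} → Prime p → ∀ c d → LeadingUnit p (c ∷ monomial d)
  monomial-leading pr c zero    1≈0 = prime∤1 pr (mod-0⇒∣ 1≈0)
  monomial-leading pr c (suc d)     = monomial-leading pr 0ℤ d

  -- If a^e ≡ 1 (mod p) for all 0 < a < p, with e > 0 and p prime, then p − 1 ≤ e:
  -- the residues 1, …, p − 1 are p − 1 distinct roots of x^e − 1.
  root-bound : ∀ {p} → Prime p → ∀ e → 0 < e → (∀ a → 0 < a → a < p → (+ a) ^ e ≈ 1ℤ [mod p ]) → p ∸ 1 ≤ e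
  root-bound {p} pr (suc d) _ a^e≈1 = ℕ.≤-pred
    (subst₂ _<_ (length-applyUpTo residue (p ∸ 1)) (length-unity d)
      (lagrange pr (applyUpTo residue (p ∸ 1)) (unity d) (monomial-leading pr -1ℤ d) roots distinct))
    where
    residue : ℕ → ℤ
    residue i = + suc i
    below : ∀ {i} → i < p ∸ 1 → suc i < p
    below {i} i<p-1 = subst (_≤ p) (ℕ.+-comm (suc i) 1) (ℕ.m≤o∸n⇒m+n≤o (suc i) (ℕ.<⇒≤ (prime>1 pr)) i<p-1)
    roots : All (Root p (unity d)) (applyUpTo residue (p ∸ 1))
    roots = All.applyUpTo⁺₁ residue (p ∸ 1) λ {i} i<p-1 →
      subst (λ v → v ≈ 0ℤ [mod p ]) (sym (eval-unity d (residue i)))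
        (mod⇒difference≈0 (a^e≈1 (suc i) (s≤s z≤n) (below i<p-1)))
    distinct : Distinct p (applyUpTo residue (p ∸ 1))
    distinct = AllPairs.applyUpTo⁺₁ residue (p ∸ 1) λ i<j j<p-1 → <⇒mod-distinct (s≤s i<j) (below j<p-1)

module Korselt where

  open import Data.Nat as ℕ using (ℕ; zero; suc; _∸_; _<_; NonZero; s≤s)
  import Data.Nat.Properties as ℕ
  open import Data.Nat.Divisibility as ℕ using (_∣_; divides)
  open import Data.Nat.Coprimality using (Coprime)
  open import Data.Nat.GCD using (gcd; gcd[m,n]∣m; gcd[m,n]∣n; gcd[m,n]≢0)
  open import Data.Nat.Primality using (Prime)
  open import Data.Integer as ℤ using (ℤ; +_; _+_; _-_; _*_; _^_; ∣_∣; 0ℤ; 1ℤ)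
  import Data.Integer.Properties as ℤ
  import Data.Integer.Divisibility.Signed as Signed
  open import Data.Integer.Tactic.RingSolver using (solve-∀)
  open import Data.Nat.Tactic.RingSolver using () renaming (solve-∀ to ℕ-solve-∀)
  open import Data.Product using (∃; _×_; _,_)
  open import Data.Sum using (inj₂)
  open import Relation.Nullary using (¬_; contradiction)
  open import Relation.Binary.PropositionalEquality
  open Arithmetic using (prime>1; coprime-∣ʳ; coprime-*ʳ)
  open Congruence
  open Fermat using (fermat-unit)
  open Lagrange using (root-bound)

  FermatCondition : ℕ → Set
  FermatCondition n = ∀ (b : ℤ) → Coprime ∣ b ∣ n → b ^ (n ∸ 1) ≈ 1ℤ [mod n ]

  binomial-first-order : ∀ {d x} → d ∣ ∣ x * x ∣ → ∀ j → (1ℤ + x) ^ j ≈ 1ℤ + + j * x [mod d ]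
  binomial-first-order {x = x} d∣x² zero    = ≡⇒mod (no-linear-term x)
    where no-linear-term : ∀ x → 1ℤ ≡ 1ℤ + 0ℤ * x
          no-linear-term = solve-∀
  binomial-first-order {x = x} d∣x² (suc j) =
    mod-trans (mod-* (≡⇒mod {a = 1ℤ + x} refl) (binomial-first-order d∣x² j))
      (by-difference (expand x (+ j)) (Signed.∣n⇒∣m*n (+ j) (Signed.∣ᵤ⇒∣ d∣x²)))
    where expand : ∀ x j → j * (x * x) ≡ (1ℤ + x) * (1ℤ + j * x) - (1ℤ + (1ℤ + j) * x)
          expand = solve-∀

  -- If n ∣ m² and (1 + m)^(n−1) ≡ 1 (mod n), then n ∣ m: to first order
  -- 1 ≡ (1 + m)^(n−1) ≡ 1 + (n − 1)·m (mod n), while n·m ≡ 0.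
  first-order⇒∣ : ∀ {n m} → .{{NonZero n}} → n ∣ m ℕ.* m → (1ℤ + + m) ^ (n ∸ 1) ≈ 1ℤ [mod n ] → n ∣ m
  first-order⇒∣ {suc n′} {m} n∣m² [1+m]^n′≈1 =
    mod-0⇒∣ (mod-trans (≡⇒mod (sym (difference (+ n′) (+ m)))) (mod-difference (multiple≈0 (+ m)) n′m≈0))
    where
    n′m≈0 : + n′ * + m ≈ 0ℤ [mod suc n′ ]
    n′m≈0 = mod-trans (≡⇒mod (cancel (+ n′ * + m)))
              (mod-difference (mod-trans (mod-sym (binomial-first-order n∣∣m²∣ n′)) [1+m]^n′≈1) (≡⇒mod {a = 1ℤ} refl))
      where
      n∣∣m²∣ : suc n′ ∣ ∣ + m * + m ∣
      n∣∣m²∣ = subst (λ k → suc n′ ∣ ∣ k ∣) (ℤ.pos-* m m) n∣m²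
      cancel : ∀ y → y ≡ (1ℤ + y) - 1ℤ
      cancel = solve-∀
    difference : ∀ a b → (1ℤ + a) * b - a * b ≡ b
    difference = solve-∀

  -- A number n ≠ 0 with the Fermat condition is squarefree: if d² ∣ n with d > 1,
  -- then m = n/d satisfies n ∣ m², so 1 + m is coprime to n and the previous
  -- lemma gives n ∣ m, contradicting 0 < m < n.
  squarefree : ∀ {n} → FermatCondition n → .{{NonZero n}} → ∀ {d} → 1 < d → ¬ (d ℕ.* d ∣ n)
  squarefree {suc n′} fermat {d} 1<d (divides q n≡q*d*d) =
    ℕ.<⇒≱ m<n (ℕ.∣⇒≤ {{m≢0}} (first-order⇒∣ n∣m² (fermat (+ suc m) 1+m⊥n)))
    where
    n m : ℕ
    n = suc n′
    m = q ℕ.* d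
    n≡m*d : n ≡ m ℕ.* d
    n≡m*d = trans n≡q*d*d (sym (ℕ.*-assoc q d d))
    n∣m² : n ∣ m ℕ.* m
    n∣m² = divides q (trans (regroup q d) (cong (q ℕ.*_) (sym n≡q*d*d)))
      where regroup : ∀ q d → (q ℕ.* d) ℕ.* (q ℕ.* d) ≡ q ℕ.* (q ℕ.* (d ℕ.* d))
            regroup = ℕ-solve-∀
    m≢0 : NonZero m
    m≢0 = ℕ.m*n≢0⇒m≢0 m {{subst NonZero n≡m*d _}}
    m<n : m < n
    m<n = subst (m <_) (sym n≡m*d) (ℕ.m<m*n m d {{m≢0}} 1<d)
    1+m⊥m : Coprime (suc m) m
    1+m⊥m = mod-1⇒coprime (ℕ-multiple⇒mod (sym (cong suc (ℕ.*-identityʳ m))))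
    1+m⊥n : Coprime ∣ + suc m ∣ n
    1+m⊥n = coprime-∣ʳ n∣m² (coprime-*ʳ 1+m⊥m 1+m⊥m)

  -- Chinese remaindering with a prime p ∤ m: for p ∤ a, the integer
  -- b = 1 + (a − 1)·m^(p−1) is ≡ a (mod p) by Fermat, ≡ 1 (mod m), and
  -- hence coprime to m·p.
  crt-lift : ∀ {p m a} → Prime p → ¬ (p ∣ m) → ¬ (p ∣ a) → ∃ λ b → b ≈ + a [mod p ] × Coprime ∣ b ∣ (m ℕ.* p)
  crt-lift {zero}        pr = contradiction (prime>1 pr) λ ()
  crt-lift {suc zero}    pr = contradiction (prime>1 pr) λ { (s≤s ()) }
  crt-lift {suc (suc k)} {m} {a} pr p∤m p∤a = b , b≈a , coprime-*ʳ (mod-1⇒coprime b≈1) (mod-unit⇒coprime pr p∤a b≈a)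
    where
    b : ℤ
    b = 1ℤ + (+ a - 1ℤ) * (+ m) ^ suc k
    b≈a : b ≈ + a [mod suc (suc k) ]
    b≈a = mod-trans (mod-+ (≡⇒mod {a = 1ℤ} refl) (mod-* (≡⇒mod {a = + a - 1ℤ} refl) (fermat-unit pr m p∤m)))
                    (≡⇒mod (collapse (+ a)))
      where collapse : ∀ a → 1ℤ + (a - 1ℤ) * 1ℤ ≡ a
            collapse = solve-∀
    b≈1 : b ≈ 1ℤ [mod m ]
    b≈1 = by-difference (factor (+ a) (+ m) ((+ m) ^ k)) (Signed.divides ((+ a - 1ℤ) * (+ m) ^ k) refl)
      where factor : ∀ a x y → ((a - 1ℤ) * y) * x ≡ (1ℤ + (a - 1ℤ) * (x * y)) - 1ℤ
            factor = solve-∀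

  -- Modulo a prime divisor p of n, the Fermat condition holds for every a with
  -- 0 < a < p: lift a to some b coprime to n and reduce b^(n−1) ≡ 1 modulo p.
  fermat-condition-mod : ∀ {n} → FermatCondition n → .{{NonZero n}} → ∀ {p} → Prime p → p ∣ n →
                         ∀ a → 0 < a → a < p → (+ a) ^ (n ∸ 1) ≈ 1ℤ [mod p ]
  fermat-condition-mod {n} fermat {p} pr p∣n@(divides m n≡m*p) a 0<a a<p
    with crt-lift {p} {m} {a} pr p∤m (ℕ.>⇒∤ {{ℕ.>-nonZero 0<a}} a<p)
    where
    p∤m : ¬ (p ∣ m)
    p∤m (divides k refl) = squarefree fermat (prime>1 pr) (divides k (trans n≡m*p (ℕ.*-assoc k p p)))
  ... | b , b≈a , b⊥m*p = mod-trans (mod-^ (n ∸ 1) (mod-sym b≈a))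
                             (mod-weaken p∣n (fermat b (subst (Coprime ∣ b ∣) (sym n≡m*p) b⊥m*p)))

  -- With g = gcd(n − 1, p − 1), Fermat's little theorem gives
  -- a^g ≡ 1 (mod p) for all 0 < a < p, so p − 1 ≤ g by the root bound.
  korselt : ∀ {n} → FermatCondition n → .{{NonZero n}} → ∀ {p} → Prime p → p ∣ n → (p ∸ 1) ∣ (n ∸ 1)
  korselt {n} fermat {p} pr p∣n = subst (_∣ n ∸ 1) g≡p-1 (gcd[m,n]∣m (n ∸ 1) (p ∸ 1))
    where
    g : ℕ
    g = gcd (n ∸ 1) (p ∸ 1)
    p-1≢0 : p ∸ 1 ≢ 0
    p-1≢0 = ℕ.m>n⇒m∸n≢0 (prime>1 pr)
    a^g≈1 : ∀ a → 0 < a → a < p → (+ a) ^ g ≈ 1ℤ [mod p ]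
    a^g≈1 a 0<a a<p = pow≈1-gcd (n ∸ 1) (p ∸ 1) (fermat-condition-mod fermat pr p∣n a 0<a a<p)
                        (fermat-unit pr a (ℕ.>⇒∤ {{ℕ.>-nonZero 0<a}} a<p))
    g≡p-1 : g ≡ p ∸ 1
    g≡p-1 = ℕ.≤-antisym (ℕ.∣⇒≤ {{ℕ.≢-nonZero p-1≢0}} (gcd[m,n]∣n (n ∸ 1) (p ∸ 1)))
              (root-bound pr g (ℕ.n≢0⇒n>0 (gcd[m,n]≢0 (n ∸ 1) (p ∸ 1) (inj₂ p-1≢0))) a^g≈1)

module Totient where

  open import Data.Nat as ℕ using (ℕ; zero; suc; _+_; _*_; _∸_; _≤_; _<_; z≤n; s≤s)
  open import Data.Nat.Properties
  open import Data.Nat.Divisibility using (_∣_; _∣?_; >⇒∤; ∣m+n∣m⇒∣n; m∣m*n)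
  open import Data.Nat.Coprimality using (Coprime; coprime?)
  open import Data.Nat.Primality using (Prime; prime⇒nonZero)
  open import Data.Nat.Tactic.RingSolver using (solve-∀)
  open import Data.Bool using (Bool; true; false; _∧_; not)
  open import Data.List using ([]; _∷_; length; filter; map; upTo; _++_; _∷ʳ_)
  import Data.List.Properties as List
  open import Data.Product using (_×_; _,_; proj₂)
  open import Function.Bundles using (_⇔_; mk⇔; Equivalence)
  open import Level using (0ℓ)
  open import Relation.Nullary using (¬_; does)
  open import Relation.Nullary.Decidable using (does-⇔; dec-false)
  open import Relation.Unary using (Pred; Decidable)
  open import Relation.Unary.Properties using (_∩?_; ∁?)
  open import Relation.Binary.PropositionalEquality
  open import Defs using (φ)
  open Arithmetic using (coprime-+ʳ⇔; coprime-prime*⇔; coprime-prime*ˡ⇔)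

  δ : Bool → ℕ
  δ true  = 1
  δ false = 0

  -- count P? a N = #{ k | a < k ≤ a + N, P k }.
  count : {P : Pred ℕ 0ℓ} → Decidable P → ℕ → ℕ → ℕ
  count P? a zero    = 0
  count P? a (suc N) = count P? a N + δ (does (P? (a + suc N)))

  φ≡count : ∀ n → φ n ≡ count (λ k → coprime? k n) 0 n
  φ≡count n = filter-count (λ k → coprime? k n) n
    where
    filter-count : {P : Pred ℕ 0ℓ} (P? : Decidable P) (N : ℕ) → length (filter P? (map suc (upTo N))) ≡ count P? 0 N
    filter-count P? zero    = refl
    filter-count P? (suc N) = begin
      length (filter P? (map suc (upTo (suc N))))
        ≡⟨ cong (λ xs → length (filter P? (map suc xs))) (sym (List.applyUpTo-∷ʳ (λ x → x) N)) ⟩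
      length (filter P? (map suc (upTo N ∷ʳ N)))
        ≡⟨ cong (λ xs → length (filter P? xs)) (List.map-++ suc (upTo N) (N ∷ [])) ⟩
      length (filter P? (map suc (upTo N) ++ suc N ∷ []))
        ≡⟨ cong length (List.filter-++ P? (map suc (upTo N)) (suc N ∷ [])) ⟩
      length (filter P? (map suc (upTo N)) ++ filter P? (suc N ∷ []))
        ≡⟨ List.length-++ (filter P? (map suc (upTo N))) ⟩
      length (filter P? (map suc (upTo N))) + length (filter P? (suc N ∷ []))
        ≡⟨ cong₂ _+_ (filter-count P? N) (singleton (suc N)) ⟩
      count P? 0 (suc N)
        ∎
      where
      open ≡-Reasoning
      singleton : ∀ x → length (filter P? (x ∷ [])) ≡ δ (does (P? x))
      singleton x with does (P? x)
      ... | true  = refl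
      ... | false = refl

  count-cong : ∀ {P Q : Pred ℕ 0ℓ} (P? : Decidable P) (Q? : Decidable Q) → (∀ k → P k ⇔ Q k) →
               ∀ a N → count P? a N ≡ count Q? a N
  count-cong P? Q? P⇔Q a zero    = refl
  count-cong P? Q? P⇔Q a (suc N) =
    cong₂ _+_ (count-cong P? Q? P⇔Q a N) (cong δ (does-⇔ (P⇔Q (a + suc N)) (P? (a + suc N)) (Q? (a + suc N))))

  count-split : ∀ {P Q : Pred ℕ 0ℓ} (P? : Decidable P) (Q? : Decidable Q) →
                ∀ a N → count P? a N ≡ count (P? ∩? Q?) a N + count (P? ∩? ∁? Q?) a N
  count-split P? Q? a zero    = refl
  count-split P? Q? a (suc N) = begin
    count P? a N + δ (does (P? k))     ≡⟨ cong₂ _+_ (count-split P? Q? a N) (δ-split (does (P? k)) (does (Q? k))) ⟩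
    (inQ + outQ) + (δ-inQ + δ-outQ)    ≡⟨ interchange inQ outQ δ-inQ δ-outQ ⟩
    (inQ + δ-inQ) + (outQ + δ-outQ)    ∎
    where
    open ≡-Reasoning
    k inQ outQ δ-inQ δ-outQ : ℕ
    k      = a + suc N
    inQ    = count (P? ∩? Q?) a N
    outQ   = count (P? ∩? ∁? Q?) a N
    δ-inQ  = δ (does (P? k) ∧ does (Q? k))
    δ-outQ = δ (does (P? k) ∧ not (does (Q? k)))
    δ-split : ∀ x y → δ x ≡ δ (x ∧ y) + δ (x ∧ not y)
    δ-split true  true  = refl
    δ-split true  false = refl
    δ-split false y     = refl
    interchange : ∀ w x y z → (w + x) + (y + z) ≡ (w + y) + (x + z)
    interchange = solve-∀

  module _ {P : Pred ℕ 0ℓ} (P? : Decidable P) where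

    count-+ : ∀ a N M → count P? a (N + M) ≡ count P? a N + count P? (a + N) M
    count-+ a N zero    = trans (cong (count P? a) (+-identityʳ N)) (sym (+-identityʳ _))
    count-+ a N (suc M) = begin
      count P? a (N + suc M)                                 ≡⟨ cong (count P? a) (+-suc N M) ⟩
      count P? a (N + M) + δ (does (P? (a + suc (N + M))))   ≡⟨ cong₂ _+_ (count-+ a N M) (cong (λ k → δ (does (P? k))) (shift a N M)) ⟩
      count P? a N + count P? (a + N) M + δ (does (P? (a + N + suc M))) ≡⟨ +-assoc (count P? a N) _ _ ⟩
      count P? a N + count P? (a + N) (suc M)                ∎
      where
      open ≡-Reasoning
      shift : ∀ a N M → a + suc (N + M) ≡ a + N + suc M
      shift = solve-∀

    count-shift : ∀ a b N → count P? (a + b) N ≡ count (λ k → P? (k + b)) a N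
    count-shift a b zero    = refl
    count-shift a b (suc N) = cong₂ _+_ (count-shift a b N) (cong (λ k → δ (does (P? k))) (shift a b N))
      where
      shift : ∀ a b N → a + b + suc N ≡ a + suc N + b
      shift = solve-∀

    count-none : ∀ a N → (∀ i → 0 < i → i ≤ N → ¬ P (a + i)) → count P? a N ≡ 0
    count-none a zero    none = refl
    count-none a (suc N) none = cong₂ _+_ (count-none a N λ i 0<i i≤N → none i 0<i (m≤n⇒m≤1+n i≤N))
      (cong δ (dec-false (P? (a + suc N)) (none (suc N) (s≤s z≤n) ≤-refl)))

  count-periodic : ∀ {P : Pred ℕ 0ℓ} (P? : Decidable P) M → (∀ k → P (k + M) ⇔ P k) →
                   ∀ j → count P? 0 (j * M) ≡ j * count P? 0 M
  count-periodic P? M periodic zero    = refl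
  count-periodic P? M periodic (suc j) = begin
    count P? 0 (M + j * M)                          ≡⟨ count-+ P? 0 M (j * M) ⟩
    count P? 0 M + count P? M (j * M)               ≡⟨ cong (count P? 0 M +_) later-periods ⟩
    count P? 0 M + j * count P? 0 M                 ∎
    where
    open ≡-Reasoning
    later-periods : count P? M (j * M) ≡ j * count P? 0 M
    later-periods = begin
      count P? M (j * M)                      ≡⟨ count-shift P? 0 M (j * M) ⟩
      count (λ k → P? (k + M)) 0 (j * M)      ≡⟨ count-cong (λ k → P? (k + M)) P? periodic 0 (j * M) ⟩
      count P? 0 (j * M)                      ≡⟨ count-periodic P? M periodic j ⟩
      j * count P? 0 M                        ∎

  -- A predicate holding only at multiples of p is counted over (0, p·j] by
  -- counting i ∈ (0, j] with P (p·i): each block (p·i, p·(i+1)] meets P at most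
  -- in its last point.
  count-multiples : ∀ {P : Pred ℕ 0ℓ} (P? : Decidable P) p → .{{ℕ.NonZero p}} → (∀ k → P k → p ∣ k) →
                    ∀ j → count P? 0 (p * j) ≡ count (λ i → P? (p * i)) 0 j
  count-multiples P? p@(suc q) only-multiples zero    = cong (count P? 0) (*-zeroʳ p)
  count-multiples {P} P? p@(suc q) only-multiples (suc j) = begin
    count P? 0 (p * suc j)                         ≡⟨ cong (count P? 0) p*[1+j]≡p*j+p ⟩
    count P? 0 (p * j + p)                         ≡⟨ count-+ P? 0 (p * j) p ⟩
    count P? 0 (p * j) + count P? (p * j) p        ≡⟨ cong₂ _+_ (count-multiples P? p only-multiples j) last-block ⟩
    count (λ i → P? (p * i)) 0 (suc j)             ∎
    where
    open ≡-Reasoning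
    p*[1+j]≡p*j+p : p * suc j ≡ p * j + p
    p*[1+j]≡p*j+p = trans (*-suc p j) (+-comm p (p * j))
    no-interior : ∀ i → 0 < i → i ≤ q → ¬ P (p * j + i)
    no-interior i 0<i i≤q P[pj+i] =
      >⇒∤ {{ℕ.>-nonZero 0<i}} (s≤s i≤q) (∣m+n∣m⇒∣n (only-multiples _ P[pj+i]) (m∣m*n j))
    last-block : count P? (p * j) p ≡ δ (does (P? (p * suc j)))
    last-block = cong₂ _+_ (count-none P? (p * j) q no-interior)
                           (cong (λ k → δ (does (P? k))) (sym p*[1+j]≡p*j+p))

  -- Among k ∈ (0, p·m] coprime to m
  -- (p·φ(m) of them, by periodicity) exactly φ(m) are multiples of p, and the
  -- others are exactly the k coprime to p·m.
  φ-prime* : ∀ {p m} → Prime p → ¬ (p ∣ m) → φ (p * m) ≡ (p ∸ 1) * φ m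
  φ-prime* {p} {m} pr p∤m = begin
    φ (p * m)                               ≡⟨ φ≡count (p * m) ⟩
    count (λ k → coprime? k (p * m)) 0 (p * m) ≡⟨ count-cong _ (C? ∩? ∁? D?) (λ _ → coprime-prime*⇔ pr) 0 (p * m) ⟩
    rest                                    ≡⟨ sym (m+n∸m≡n (φ m) rest) ⟩
    φ m + rest ∸ φ m                        ≡⟨ cong (_∸ φ m) (sym p*φm≡φm+rest) ⟩
    p * φ m ∸ φ m                           ≡⟨ cong (p * φ m ∸_) (sym (*-identityˡ (φ m))) ⟩
    p * φ m ∸ 1 * φ m                       ≡⟨ sym (*-distribʳ-∸ (φ m) p 1) ⟩
    (p ∸ 1) * φ m                           ∎
    where
    open ≡-Reasoning
    C? : Decidable (λ k → Coprime k m)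
    C? k = coprime? k m
    D? : Decidable (p ∣_)
    D? k = p ∣? k
    rest : ℕ
    rest = count (C? ∩? ∁? D?) 0 (p * m)
    multiples : count (C? ∩? D?) 0 (p * m) ≡ φ m
    multiples = begin
      count (C? ∩? D?) 0 (p * m)                    ≡⟨ count-multiples (C? ∩? D?) p {{prime⇒nonZero pr}} (λ _ → proj₂) m ⟩
      count (λ i → (C? ∩? D?) (p * i)) 0 m          ≡⟨ count-cong _ C? multiple⇔ 0 m ⟩
      count C? 0 m                                  ≡⟨ sym (φ≡count m) ⟩
      φ m                                           ∎
      where
      multiple⇔ : ∀ i → (Coprime (p * i) m × p ∣ p * i) ⇔ Coprime i m
      multiple⇔ i = mk⇔ to′ from′
        where
        open Equivalence (coprime-prime*ˡ⇔ {p} {i} {m} pr p∤m)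
        to′ : Coprime (p * i) m × p ∣ p * i → Coprime i m
        to′ (pi⊥m , _) = to pi⊥m
        from′ : Coprime i m → Coprime (p * i) m × p ∣ p * i
        from′ i⊥m = from i⊥m , m∣m*n i
    p*φm≡φm+rest : p * φ m ≡ φ m + rest
    p*φm≡φm+rest = begin
      p * φ m                                       ≡⟨ cong (p *_) (φ≡count m) ⟩
      p * count C? 0 m                              ≡⟨ sym (count-periodic C? m (λ _ → coprime-+ʳ⇔) p) ⟩
      count C? 0 (p * m)                            ≡⟨ count-split C? D? 0 (p * m) ⟩
      count (C? ∩? D?) 0 (p * m) + rest             ≡⟨ cong (_+ rest) multiples ⟩
      φ m + rest                                    ∎

open import Defs
open import Data.Nat as ℕ using (ℕ; suc; _∸_; _^_; _≥_; NonZero; s≤s; z≤n)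
open import Data.Nat.Divisibility using (_∣_; ∣-trans; m∣m*n; n∣m*n; *-monoʳ-∣; *-pres-∣; ∣-reflexive; 1∣_)
open import Data.Nat.Primality using (Prime; composite⇒nonZero; composite⇒nonTrivial)
open import Data.Nat.Primality.Factorisation using (factorise; PrimeFactorisation)
open import Data.Nat.ListAction using (product)
open import Data.List using (List; []; _∷_; length)
open import Data.List.Relation.Unary.All using (All; []; _∷_)
open import Data.Product using (∃; _×_; _,_)
open import Relation.Nullary using (¬_; contradiction)
open import Relation.Binary.PropositionalEquality
open Arithmetic using (prime>1)
open Congruence using (fromDefs)
open Korselt using (FermatCondition; squarefree; korselt)
open Totient using (φ-prime*)

-- For n ≠ 0 with the Fermat condition and primes ps with ∏ps ∣ n:
-- φ(∏ps) ∣ (n − 1)^|ps|, as φ(p·∏rest) = (p − 1)·φ(∏rest) (n is squarefree, so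
-- p ∤ ∏rest) and (p − 1) ∣ (n − 1) by Korselt's criterion.
φ-product∣ : ∀ {n} → FermatCondition n → .{{NonZero n}} → ∀ ps → All Prime ps → product ps ∣ n →
             φ (product ps) ∣ (n ∸ 1) ^ length ps
φ-product∣ fermat []       []         _      = 1∣ 1
φ-product∣ {n} fermat (p ∷ ps) (pr ∷ prs) ∏∣n =
  subst (_∣ (n ∸ 1) ^ suc (length ps)) (sym (φ-prime* pr p∤∏ps))
    (*-pres-∣ (korselt fermat pr (∣-trans (m∣m*n (product ps)) ∏∣n))
              (φ-product∣ fermat ps prs (∣-trans (n∣m*n p) ∏∣n)))
  where
  p∤∏ps : ¬ (p ∣ product ps)
  p∤∏ps p∣∏ps = squarefree fermat (prime>1 pr) (∣-trans (*-monoʳ-∣ p p∣∏ps) ∏∣n)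

mainTheorem5 : ∀ (n : ℕ) → Carmichael n → ∃ λ (k : ℕ) → k ≥ 1 × φ n ∣ (n ∸ 1) ^ k
mainTheorem5 n (composite , fermat) =
  length ps , k≥1 , subst (λ m → φ m ∣ (n ∸ 1) ^ length ps) (sym n≡∏ps) φ[∏ps]∣
  where
  instance
    n≢0 : NonZero n
    n≢0 = composite⇒nonZero composite
  factorisation : PrimeFactorisation n
  factorisation = factorise n
  ps : List ℕ
  ps = PrimeFactorisation.factors factorisation
  n≡∏ps : n ≡ product ps
  n≡∏ps = PrimeFactorisation.isFactorisation factorisation
  k≥1 : length ps ≥ 1
  k≥1 with ps | n≡∏ps
  ... | []    | n≡1 = contradiction n≡1 (ℕ.nonTrivial⇒≢1 {{composite⇒nonTrivial composite}})
  ... | _ ∷ _ | _   = s≤s z≤n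
  fermat-condition : FermatCondition n
  fermat-condition b b⊥n = fromDefs (fermat b b⊥n)
  φ[∏ps]∣ : φ (product ps) ∣ (n ∸ 1) ^ length ps
  φ[∏ps]∣ = φ-product∣ fermat-condition ps (PrimeFactorisation.factorsPrime factorisation) (∣-reflexive (sym n≡∏ps))
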